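{- For all integers $n,k,m$ with $n\geq k-1\geq 0$, $$w_{n+2,k,m}=\frac{2(n+2)(n-k+1)}{(n-k+2)(n-k+3)}w_{n+1,k,m}-\frac{(n+2)(n-2k+1)}{(n-k+2)(n-k+3)}w_{n+1,k,m-1}+\frac{(n+1)(n+2)(n-k)}{(n-k+2)^2(n-k+3)}\left(w_{n,k,m-1}-w_{n,k,m}\right).$$
   Context: For integers $n,k,m$ (with $k\ge1$) define $w_{n,k,m}=\frac{1}{k}\binom{n}{k-1}\binom{n-k-1}{m-1}\binom{k}{m}$ if $0<m\le k$ and $k+m\le n$; $w_{n,k,m}=1$ if $m=0$ and $n=k$; and $w_{n,k,m}=0$ otherwise. -}

module Defs where

open import Data.Bool using (if_then_else_; _∧_)
open import Data.Nat as ℕ using (ℕ; zero; suc; _∸_; _≟_; _≤?_)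
open import Data.Nat.Combinatorics using (_C_)
open import Data.Integer as ℤ using (ℤ; +_; -[1+_])
open import Data.Rational using (ℚ; _/_; 0ℚ; 1ℚ)
open import Relation.Nullary.Decidable using (does)

-- w n k m  =  w_{n,k,m}  (n, k natural numbers, m an integer).
--   w_{n,k,m} = (1/k) C(n,k-1) C(n-k-1,m-1) C(k,m)   if 0 < m ≤ k and k + m ≤ n
--   w_{n,k,m} = 1                                     if m = 0 and n = k
--   w_{n,k,m} = 0                                     otherwise.
-- (The paper only defines w for k ≥ 1; for k = 0 this returns the "otherwise"/m=0 clauses.
--  Only k ≥ 1 is used in the statement.)
-- In the first clause all binomial arguments are natural numbers since k + m ≤ n.
w : ℕ → ℕ → ℤ → ℚ
w n k -[1+ _ ] = 0ℚ
w n k (+ zero) = if does (n ≟ k) then 1ℚ else 0ℚ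
w n zero (+ suc m') = 0ℚ
w n (suc k') (+ suc m') =
  if does (suc m' ≤? suc k') ∧ does (suc k' ℕ.+ suc m' ≤? n)
  then (+ ((n C k') ℕ.* ((n ∸ suc k' ∸ 1) C m') ℕ.* (suc k' C suc m'))) / suc k'
  else 0ℚ

-- Write N = (k − 1) + y. Then k · w_{N,k,m} = C(N,k−1) · w′ k y m, where w′ k y m = C(y−2,m−1) C(k,m)
-- (with the convention (−1) C (−1) = 1). Going from N = n to n+1 to n+2 the factor C(N,k−1) is
-- multiplied by (n+1)/(n−k+2) and then (n+2)/(n−k+3); clearing these ratios and the denominators,
-- the recurrence becomes, with j = n−k+1,
--   (j+1) w′ k (j+2) m = 2j w′ k (j+1) m − (j−k) w′ k (j+1) (m−1) + (j−1) (w′ k j (m−1) − w′ k j m),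
-- which is a linear consequence of Pascal's rule and absorption for C(y−2,m−1) and of
-- m C(k,m) + (m−1) C(k,m−1) = k C(k,m−1).

module Submission where

open import Defs
open import Data.Bool using (if_then_else_; _∧_)
open import Data.Nat as ℕ using (ℕ; zero; suc; _∸_; _≤_; _≟_; _≤?_; s≤s; NonZero)
import Data.Nat.Properties as ℕₚ
open import Data.Nat.Combinatorics using (_C_; nCk+nC[k+1]≡[n+1]C[k+1]; nCk≡nC[n∸k]; k>n⇒nCk≡0; nC1≡n)
open import Data.Integer as ℤ using (ℤ; +_; -[1+_]; 0ℤ; 1ℤ)
import Data.Integer.Properties as ℤₚ
open import Data.Rational using (ℚ; _/_; 0ℚ; toℚᵘ)
open import Data.Rational.Properties using (toℚᵘ-injective; toℚᵘ-fromℚᵘ; toℚᵘ-homo-+; toℚᵘ-homo-*; toℚᵘ-homo‿-; 0/n≡0)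
import Data.Rational.Unnormalised as ℚᵘ
import Data.Rational.Unnormalised.Properties as ℚᵘ
open import Relation.Nullary using (Dec; yes; no; ¬_)
open import Relation.Nullary.Decidable using (does)
open import Relation.Binary.PropositionalEquality using (_≡_; refl; sym; trans; cong; cong₂; subst; module ≡-Reasoning)
open import Data.Empty using (⊥-elim)

module _ where
  open import Data.Nat using (_+_; _*_)
  import Data.Nat.Tactic.RingSolver as ℕ-Solver
  open ≡-Reasoning

  [k+1]*[n+1]C[k+1]≡[n+1]*nCk : ∀ n k → suc k * (suc n C suc k) ≡ suc n * (n C k)
  [k+1]*[n+1]C[k+1]≡[n+1]*nCk zero    zero    = refl
  [k+1]*[n+1]C[k+1]≡[n+1]*nCk zero    (suc k) = ℕₚ.*-zeroʳ (suc (suc k))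
  [k+1]*[n+1]C[k+1]≡[n+1]*nCk (suc n) zero    =
    trans (ℕₚ.+-identityʳ _) (trans (nC1≡n (suc (suc n))) (sym (ℕₚ.*-identityʳ (suc (suc n)))))
  [k+1]*[n+1]C[k+1]≡[n+1]*nCk (suc n) (suc k) = begin
    suc (suc k) * (suc (suc n) C suc (suc k))  ≡⟨ cong (suc (suc k) *_) (nCk+nC[k+1]≡[n+1]C[k+1] (suc n) (suc k)) ⟨
    suc (suc k) * (a + b)                      ≡⟨ distribute k a b ⟩
    suc k * a + a + suc (suc k) * b            ≡⟨ cong₂ (λ u v → u + a + v) ([k+1]*[n+1]C[k+1]≡[n+1]*nCk n k)
                                                                             ([k+1]*[n+1]C[k+1]≡[n+1]*nCk n (suc k)) ⟩
    suc n * c + a + suc n * d                  ≡⟨ collect n a c d ⟩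
    suc n * (c + d) + a                        ≡⟨ cong (λ u → suc n * u + a) (nCk+nC[k+1]≡[n+1]C[k+1] n k) ⟩
    suc n * a + a                              ≡⟨ absorb n a ⟩
    suc (suc n) * a                            ∎
    where
    a = suc n C suc k
    b = suc n C suc (suc k)
    c = n C k
    d = n C suc k
    distribute : ∀ k a b → suc (suc k) * (a + b) ≡ suc k * a + a + suc (suc k) * b
    distribute = ℕ-Solver.solve-∀
    collect : ∀ n a c d → suc n * c + a + suc n * d ≡ suc n * (c + d) + a
    collect = ℕ-Solver.solve-∀
    absorb : ∀ n a → suc n * a + a ≡ suc (suc n) * a
    absorb = ℕ-Solver.solve-∀

  [j+k]Ck≡[j+k]Cj : ∀ j k → (j + k) C k ≡ (j + k) C j
  [j+k]Ck≡[j+k]Cj j k = trans (nCk≡nC[n∸k] (ℕₚ.m≤n+m k j)) (cong ((j + k) C_) (ℕₚ.m+n∸n≡m j k))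

  [j+1]*[j+1+k]Ck≡[j+1+k]*[j+k]Ck : ∀ j k → suc j * ((suc j + k) C k) ≡ (suc j + k) * ((j + k) C k)
  [j+1]*[j+1+k]Ck≡[j+1+k]*[j+k]Ck j k = begin
    suc j * (suc (j + k) C k)      ≡⟨ cong (suc j *_) ([j+k]Ck≡[j+k]Cj (suc j) k) ⟩
    suc j * (suc (j + k) C suc j)  ≡⟨ [k+1]*[n+1]C[k+1]≡[n+1]*nCk (j + k) j ⟩
    suc (j + k) * ((j + k) C j)    ≡⟨ cong (suc (j + k) *_) ([j+k]Ck≡[j+k]Cj j k) ⟨
    suc (j + k) * ((j + k) C k)    ∎

  [q+1]*nC[q+1]+q*nCq≡n*nCq : ∀ n q → suc q * (n C suc q) + q * (n C q) ≡ n * (n C q)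
  [q+1]*nC[q+1]+q*nCq≡n*nCq zero    zero    = refl
  [q+1]*nC[q+1]+q*nCq≡n*nCq zero    (suc q) = cong₂ _+_ (ℕₚ.*-zeroʳ (suc (suc q))) (ℕₚ.*-zeroʳ (suc q))
  [q+1]*nC[q+1]+q*nCq≡n*nCq (suc n) zero    = trans (ℕₚ.+-identityʳ _) ([k+1]*[n+1]C[k+1]≡[n+1]*nCk n 0)
  [q+1]*nC[q+1]+q*nCq≡n*nCq (suc n) (suc q) = begin
    suc (suc q) * (suc n C suc (suc q)) + suc q * (suc n C suc q)
      ≡⟨ cong₂ _+_ ([k+1]*[n+1]C[k+1]≡[n+1]*nCk n (suc q)) ([k+1]*[n+1]C[k+1]≡[n+1]*nCk n q) ⟩
    suc n * (n C suc q) + suc n * (n C q)  ≡⟨ ℕₚ.*-distribˡ-+ (suc n) (n C suc q) (n C q) ⟨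
    suc n * (n C suc q + n C q)            ≡⟨ cong (suc n *_) (ℕₚ.+-comm (n C suc q) (n C q)) ⟩
    suc n * (n C q + n C suc q)            ≡⟨ cong (suc n *_) (nCk+nC[k+1]≡[n+1]C[k+1] n q) ⟩
    suc n * (suc n C suc q)                ∎

  -- shiftedC y q = C(y − 2, q − 1), with (−1) C (−1) = 1 so that w_{k,k,0} = 1 fits the product formula.
  shiftedC : ℕ → ℕ → ℕ
  shiftedC zero          _       = 0
  shiftedC (suc zero)    zero    = 1
  shiftedC (suc zero)    (suc _) = 0
  shiftedC (suc (suc _)) zero    = 0
  shiftedC (suc (suc y)) (suc q) = y C q

  shiftedC-pascal : ∀ y q → shiftedC (suc y) (suc q) ≡ shiftedC y (suc q) + shiftedC y q
  shiftedC-pascal zero                zero    = refl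
  shiftedC-pascal zero                (suc q) = refl
  shiftedC-pascal (suc zero)          zero    = refl
  shiftedC-pascal (suc zero)          (suc q) = refl
  shiftedC-pascal (suc (suc y))       zero    = refl
  shiftedC-pascal (suc (suc y))       (suc q) =
    trans (sym (nCk+nC[k+1]≡[n+1]C[k+1] y q)) (ℕₚ.+-comm (y C q) (y C suc q))

  shiftedC-absorb : ∀ y q → q * shiftedC (suc (suc y)) (suc q) ≡ y * shiftedC (suc y) q
  shiftedC-absorb zero     zero    = refl
  shiftedC-absorb zero     (suc q) = ℕₚ.*-zeroʳ (suc q)
  shiftedC-absorb (suc y)  zero    = sym (ℕₚ.*-zeroʳ (suc y))
  shiftedC-absorb (suc y)  (suc q) = [k+1]*[n+1]C[k+1]≡[n+1]*nCk y q

  shiftedC-absorbℤ : ∀ y q → + q ℤ.* + shiftedC (suc y) (suc q) ≡ (+ y ℤ.- 1ℤ) ℤ.* + shiftedC y q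
  shiftedC-absorbℤ zero    q = trans (ℤₚ.*-zeroʳ (+ q)) (sym (ℤₚ.*-zeroʳ -[1+ 0 ]))
  shiftedC-absorbℤ (suc y) q =
    trans (sym (ℤₚ.pos-* q _)) (trans (cong +_ (shiftedC-absorb y q)) (ℤₚ.pos-* y _))

  [y-1]*shiftedC[y,0]≡0 : ∀ y → (+ y ℤ.- 1ℤ) ℤ.* + shiftedC y 0 ≡ 0ℤ
  [y-1]*shiftedC[y,0]≡0 zero          = refl
  [y-1]*shiftedC[y,0]≡0 (suc zero)    = refl
  [y-1]*shiftedC[y,0]≡0 (suc (suc y)) = ℤₚ.*-zeroʳ (+ suc y)

module _ where
  open import Data.Integer using (_+_; _-_; _*_; -_)
  import Data.Integer.Tactic.RingSolver as ℤ-Solver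

  [q+1]*nC[q+1]+q*nCqℤ : ∀ n q → (1ℤ + + q) * + (n C suc q) + + q * + (n C q) ≡ + n * + (n C q)
  [q+1]*nC[q+1]+q*nCqℤ n q =
    trans (cong₂ _+_ (sym (ℤₚ.pos-* (suc q) _)) (sym (ℤₚ.pos-* q _)))
          (trans (cong +_ ([q+1]*nC[q+1]+q*nCq≡n*nCq n q)) (ℤₚ.pos-* n _))

  [j+1]*[j+1+k]Ck≡[j+1+k]*[j+k]Ckℤ : ∀ j k →
    + suc j * + ((suc j ℕ.+ k) C k) ≡ + (suc j ℕ.+ k) * + ((j ℕ.+ k) C k)
  [j+1]*[j+1+k]Ck≡[j+1+k]*[j+k]Ckℤ j k =
    trans (sym (ℤₚ.pos-* (suc j) _))
          (trans (cong +_ ([j+1]*[j+1+k]Ck≡[j+1+k]*[j+k]Ck j k)) (ℤₚ.pos-* (suc j ℕ.+ k) _))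

  equal-by-certificate : ∀ {l r} a b c {x₁ y₁ x₂ y₂ x₃ y₃ : ℤ} →
    l - r ≡ a * (x₁ - y₁) + b * (x₂ - y₂) + c * (x₃ - y₃) →
    x₁ ≡ y₁ → x₂ ≡ y₂ → x₃ ≡ y₃ → l ≡ r
  equal-by-certificate {l} {r} a b c {x₁} {_} {x₂} {_} {x₃} certificate refl refl refl =
    ℤₚ.i-j≡0⇒i≡j l r (trans certificate (defects-vanish a b c x₁ x₂ x₃))
    where
    defects-vanish : ∀ a b c x₁ x₂ x₃ → a * (x₁ - x₁) + b * (x₂ - x₂) + c * (x₃ - x₃) ≡ 0ℤ
    defects-vanish = ℤ-Solver.solve-∀

  pascal-absorption-recurrence : ∀ {j k p c₂ c₁ c₁′ c₀ c₀′ e e′ : ℤ} →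
    c₂ ≡ c₁ + c₁′ → c₁ ≡ c₀ + c₀′ →
    p * c₂ ≡ j * c₁′ → p * c₁ ≡ (j - 1ℤ) * c₀′ →
    (1ℤ + p) * e + p * e′ ≡ k * e′ →
    (j + 1ℤ) * (c₂ * e) ≡ + 2 * j * (c₁ * e) - (j - k) * (c₁′ * e′) + (j - 1ℤ) * (c₀′ * e′ - c₀ * e)
  pascal-absorption-recurrence {j} {k} {p} {c₁′ = c₁′} {c₀} {c₀′} {e} {e′} refl refl absorb₂ absorb₁ lower =
    equal-by-certificate c₁′ (e + e′) (e + e′) (certificate j k p c₁′ c₀ c₀′ e e′) lower (sym absorb₂) absorb₁
    where
    certificate : ∀ j k p c₁′ c₀ c₀′ e e′ →
      (j + 1ℤ) * ((c₀ + c₀′ + c₁′) * e)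
        - (+ 2 * j * ((c₀ + c₀′) * e) - (j - k) * (c₁′ * e′) + (j - 1ℤ) * (c₀′ * e′ - c₀ * e))
      ≡ c₁′ * ((1ℤ + p) * e + p * e′ - k * e′)
        + (e + e′) * (j * c₁′ - p * (c₀ + c₀′ + c₁′))
        + (e + e′) * (p * (c₀ + c₀′) - (j - 1ℤ) * c₀′)
    certificate = ℤ-Solver.solve-∀

  -- The right-hand side is the cross-multiplied form that ℚᵘ's arithmetic computes definitionally.
  rescaled : ∀ P a₁ a₂ a₃ P₁ P₂ P₃ P₄ K D₁ D₃ →
    P * (D₁ * D₃) ≡ (a₁ * P₁ - a₂ * P₂) * D₃ + a₃ * (P₃ - P₄) * D₁ →
    P * ((D₁ * K) * (D₁ * K) * (D₃ * (K * K)))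
      ≡ ((a₁ * P₁ * (D₁ * K) + - (a₂ * P₂) * (D₁ * K)) * (D₃ * (K * K))
         + a₃ * (P₃ * K + - P₄ * K) * ((D₁ * K) * (D₁ * K))) * K
  rescaled P a₁ a₂ a₃ P₁ P₂ P₃ P₄ K D₁ D₃ numerators = ℤₚ.i-j≡0⇒i≡j _ _ (begin
    _ ≡⟨ certificate P a₁ a₂ a₃ P₁ P₂ P₃ P₄ K D₁ D₃ ⟩
    D₁ * K * K * K * K * (P * (D₁ * D₃) - ((a₁ * P₁ - a₂ * P₂) * D₃ + a₃ * (P₃ - P₄) * D₁))
      ≡⟨ cong (D₁ * K * K * K * K *_) (ℤₚ.i≡j⇒i-j≡0 numerators) ⟩
    D₁ * K * K * K * K * 0ℤ ≡⟨ ℤₚ.*-zeroʳ (D₁ * K * K * K * K) ⟩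
    0ℤ ∎)
    where
    open ≡-Reasoning
    certificate : ∀ P a₁ a₂ a₃ P₁ P₂ P₃ P₄ K D₁ D₃ →
      P * ((D₁ * K) * (D₁ * K) * (D₃ * (K * K)))
        - ((a₁ * P₁ * (D₁ * K) + - (a₂ * P₂) * (D₁ * K)) * (D₃ * (K * K))
           + a₃ * (P₃ * K + - P₄ * K) * ((D₁ * K) * (D₁ * K))) * K
      ≡ D₁ * K * K * K * K * (P * (D₁ * D₃) - ((a₁ * P₁ - a₂ * P₂) * D₃ + a₃ * (P₃ - P₄) * D₁))
    certificate = ℤ-Solver.solve-∀

  w′ : ℕ → ℕ → ℤ → ℤ
  w′ k y (+ q)    = + shiftedC y q * + (k C q)
  w′ k y -[1+ _ ] = 0ℤ

  w′-recurrence : ∀ k j m →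
    (+ j + 1ℤ) * w′ k (suc (suc j)) m
      ≡ + 2 * + j * w′ k (suc j) m - (+ j - + k) * w′ k (suc j) (m - 1ℤ)
        + (+ j - 1ℤ) * (w′ k j (m - 1ℤ) - w′ k j m)
  w′-recurrence k j -[1+ _ ] = all-zero (+ j) (+ k)
    where
    all-zero : ∀ j k → (j + 1ℤ) * 0ℤ ≡ + 2 * j * 0ℤ - (j - k) * 0ℤ + (j - 1ℤ) * (0ℤ - 0ℤ)
    all-zero = ℤ-Solver.solve-∀
  w′-recurrence k j (+ zero) =
    equal-by-certificate 1ℤ (- + 2) 1ℤ
      (certificate (+ j) (+ k) (+ shiftedC (suc (suc j)) 0) (+ shiftedC (suc j) 0) (+ shiftedC j 0))
      ([y-1]*shiftedC[y,0]≡0 (suc (suc j))) ([y-1]*shiftedC[y,0]≡0 (suc j)) ([y-1]*shiftedC[y,0]≡0 j)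
    where
    certificate : ∀ j k c₂ c₁ c₀ →
      (j + 1ℤ) * (c₂ * 1ℤ) - (+ 2 * j * (c₁ * 1ℤ) - (j - k) * 0ℤ + (j - 1ℤ) * (0ℤ - c₀ * 1ℤ))
      ≡ 1ℤ * ((1ℤ + j) * c₂ - 0ℤ) + (- + 2) * (j * c₁ - 0ℤ) + 1ℤ * ((j - 1ℤ) * c₀ - 0ℤ)
    certificate = ℤ-Solver.solve-∀
  w′-recurrence k j (+ suc q) =
    pascal-absorption-recurrence {+ j} {+ k} {+ q} {c₀ = + shiftedC j (suc q)} {e = + (k C suc q)} {e′ = + (k C q)}
      (cong +_ (shiftedC-pascal (suc j) q)) (cong +_ (shiftedC-pascal j q))
      (shiftedC-absorbℤ (suc j) q) (shiftedC-absorbℤ j q) ([q+1]*nC[q+1]+q*nCqℤ k q)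

  numerator-recurrence : ∀ (j κ : ℕ) {b₀ b₁ b₂ x₂ x₁ y₁ y₀ x₀ : ℤ} →
    (+ j + 1ℤ) * x₂ ≡ + 2 * + j * x₁ - (+ j - + suc κ) * y₁ + (+ j - 1ℤ) * (y₀ - x₀) →
    + suc j * b₁ ≡ + suc (j ℕ.+ κ) * b₀ →
    + suc (suc j) * b₂ ≡ + suc (suc (j ℕ.+ κ)) * b₁ →
    b₂ * x₂ * (+ (suc j ℕ.* suc (suc j)) * + (suc j ℕ.* suc j ℕ.* suc (suc j)))
      ≡ (+ (2 ℕ.* suc (suc (j ℕ.+ κ)) ℕ.* j) * (b₁ * x₁)
          - + suc (suc (j ℕ.+ κ)) * (+ (j ℕ.+ κ) - + (2 ℕ.* suc κ) + 1ℤ) * (b₁ * y₁)) * + (suc j ℕ.* suc j ℕ.* suc (suc j))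
        + + (suc (j ℕ.+ κ) ℕ.* suc (suc (j ℕ.+ κ))) * (+ (j ℕ.+ κ) - + suc κ) * (b₀ * y₀ - b₀ * x₀) * + (suc j ℕ.* suc (suc j))
  numerator-recurrence j κ {b₀} {b₁} {b₂} {x₂} {x₁} {y₁} {y₀} {x₀} reduced step₁ step₂ =
    trans
      (equal-by-certificate
        ((1ℤ + J) * (+ 2 + J) * (+ 2 + N) * (1ℤ + J) * b₁)
        ((1ℤ + J) * (+ 2 + J) * (+ 2 + N) * (J - 1ℤ) * (y₀ - x₀))
        ((1ℤ + J) * (+ 2 + J) * (1ℤ + J) * (1ℤ + J) * x₂)
        (certificate J (+ κ) b₀ b₁ b₂ x₂ x₁ y₁ y₀ x₀) reduced step₁ step₂)
      (cong (λ a → (a * (b₁ * x₁) - A₂) * D₃ + A₃) (sym (ℤₚ.pos-* (2 ℕ.* suc (suc (j ℕ.+ κ))) j)))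
    where
    J N A₂ A₃ D₃ : ℤ
    J = + j
    N = + j + + κ
    A₂ = + suc (suc (j ℕ.+ κ)) * (+ (j ℕ.+ κ) - + (2 ℕ.* suc κ) + 1ℤ) * (b₁ * y₁)
    A₃ = + (suc (j ℕ.+ κ) ℕ.* suc (suc (j ℕ.+ κ))) * (+ (j ℕ.+ κ) - + suc κ) * (b₀ * y₀ - b₀ * x₀) * + (suc j ℕ.* suc (suc j))
    D₃ = + (suc j ℕ.* suc j ℕ.* suc (suc j))
    certificate : ∀ J K b₀ b₁ b₂ x₂ x₁ y₁ y₀ x₀ → let N = J + K in
      b₂ * x₂ * ((1ℤ + J) * (+ 2 + J) * ((1ℤ + J) * (1ℤ + J) * (+ 2 + J)))
        - ((+ 2 * (+ 2 + N) * J * (b₁ * x₁) - (+ 2 + N) * (N - + 2 * (1ℤ + K) + 1ℤ) * (b₁ * y₁)) * ((1ℤ + J) * (1ℤ + J) * (+ 2 + J))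
           + (1ℤ + N) * (+ 2 + N) * (N - (1ℤ + K)) * (b₀ * y₀ - b₀ * x₀) * ((1ℤ + J) * (+ 2 + J)))
      ≡ (1ℤ + J) * (+ 2 + J) * (+ 2 + N) * (1ℤ + J) * b₁
          * ((J + 1ℤ) * x₂ - (+ 2 * J * x₁ - (J - (1ℤ + K)) * y₁ + (J - 1ℤ) * (y₀ - x₀)))
        + (1ℤ + J) * (+ 2 + J) * (+ 2 + N) * (J - 1ℤ) * (y₀ - x₀) * ((1ℤ + J) * b₁ - (1ℤ + N) * b₀)
        + (1ℤ + J) * (+ 2 + J) * (1ℤ + J) * (1ℤ + J) * x₂ * ((+ 2 + J) * b₂ - (+ 2 + N) * b₁)
    certificate = ℤ-Solver.solve-∀

module _ where
  open import Data.Nat using (_+_; _*_)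
  open ≡-Reasoning

  if-true : ∀ {A : Set} (a? : Dec A) {x y : ℚ} → A → (if does a? then x else y) ≡ x
  if-true (yes _) _ = refl
  if-true (no ¬a) a = ⊥-elim (¬a a)

  if-false : ∀ {A : Set} (a? : Dec A) {x y : ℚ} → ¬ A → (if does a? then x else y) ≡ y
  if-false (yes a) ¬a = ⊥-elim (¬a a)
  if-false (no _)  _  = refl

  if-∧-false : ∀ {A B : Set} (a? : Dec A) (b? : Dec B) {x y : ℚ} → ¬ B → (if does a? ∧ does b? then x else y) ≡ y
  if-∧-false (yes _) (yes b) ¬b = ⊥-elim (¬b b)
  if-∧-false (yes _) (no _)  _  = refl
  if-∧-false (no _)  _       _  = refl

  if-∧-redundant : ∀ {A B : Set} (a? : Dec A) (b? : Dec B) {x v : ℚ} →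
    x ≡ v → (¬ A → v ≡ 0ℚ) → (¬ B → v ≡ 0ℚ) → (if does a? ∧ does b? then x else 0ℚ) ≡ v
  if-∧-redundant (yes _) (yes _) x≡v _     _     = x≡v
  if-∧-redundant (yes _) (no ¬b) _   _     v≡0ᴮ = sym (v≡0ᴮ ¬b)
  if-∧-redundant (no ¬a) _       _   v≡0ᴬ _     = sym (v≡0ᴬ ¬a)

  toℚᵘ-/ : ∀ i d → toℚᵘ (i / suc d) ℚᵘ.≃ ℚᵘ.mkℚᵘ i d
  toℚᵘ-/ i d = toℚᵘ-fromℚᵘ (ℚᵘ.mkℚᵘ i d)

  /-≡-/ : ∀ {i j} d e → i ℤ.* + suc e ≡ j ℤ.* + suc d → i / suc d ≡ j / suc e
  /-≡-/ {i} {j} d e eq = toℚᵘ-injective (ℚᵘ.≃-trans (toℚᵘ-/ i d) (ℚᵘ.≃-trans (ℚᵘ.*≡* eq) (ℚᵘ.≃-sym (toℚᵘ-/ j e))))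

  /-zero : ∀ {i} d → i ≡ 0ℤ → i / suc d ≡ 0ℚ
  /-zero d refl = 0/n≡0 (suc d)

  pos-*-assoc : ∀ a b c → + (a * b * c) ≡ + a ℤ.* (+ b ℤ.* + c)
  pos-*-assoc a b c = begin
    + (a * b * c)            ≡⟨ ℤₚ.pos-* (a * b) c ⟩
    + (a * b) ℤ.* + c        ≡⟨ cong (ℤ._* + c) (ℤₚ.pos-* a b) ⟩
    + a ℤ.* + b ℤ.* + c      ≡⟨ ℤₚ.*-assoc (+ a) (+ b) (+ c) ⟩
    + a ℤ.* (+ b ℤ.* + c)    ∎

  w-as-fraction : ∀ y κ m → w (y + κ) (suc κ) m ≡ (+ ((y + κ) C κ) ℤ.* w′ (suc κ) y m) / suc κ
  w-as-fraction y κ -[1+ _ ] = sym (/-zero κ (ℤₚ.*-zeroʳ (+ ((y + κ) C κ))))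
  w-as-fraction zero κ (+ zero) =
    trans (if-false (κ ≟ suc κ) (ℕₚ.<⇒≢ (ℕₚ.n<1+n κ))) (sym (/-zero κ (ℤₚ.*-zeroʳ (+ (κ C κ)))))
  w-as-fraction (suc zero) κ (+ zero) =
    trans (if-true (suc κ ≟ suc κ) refl) (/-≡-/ {1ℤ} {+ (suc κ C κ) ℤ.* w′ (suc κ) 1 (+ 0)} 0 κ numerators)
    where
    numerators : 1ℤ ℤ.* + suc κ ≡ + (suc κ C κ) ℤ.* (+ 1 ℤ.* + 1) ℤ.* + 1
    numerators = begin
      1ℤ ℤ.* + suc κ               ≡⟨ ℤₚ.*-identityˡ (+ suc κ) ⟩
      + suc κ                      ≡⟨ cong +_ (trans ([j+k]Ck≡[j+k]Cj 1 κ) (nC1≡n (suc κ))) ⟨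
      + (suc κ C κ)                ≡⟨ ℤₚ.*-identityʳ _ ⟨
      + (suc κ C κ) ℤ.* 1ℤ         ≡⟨ ℤₚ.*-identityʳ _ ⟨
      + (suc κ C κ) ℤ.* 1ℤ ℤ.* 1ℤ  ∎
  w-as-fraction (suc (suc y)) κ (+ zero) =
    trans (if-false (suc (suc y) + κ ≟ suc κ) (ℕₚ.>⇒≢ (s≤s (s≤s (ℕₚ.m≤n+m κ y)))))
          (sym (/-zero κ (ℤₚ.*-zeroʳ (+ ((suc (suc y) + κ) C κ)))))
  w-as-fraction zero κ (+ suc q) =
    trans (if-∧-false (suc q ≤? suc κ) (suc κ + suc q ≤? κ) (ℕₚ.<⇒≱ (s≤s (ℕₚ.m≤m+n κ (suc q)))))
          (sym (/-zero κ (ℤₚ.*-zeroʳ (+ (κ C κ)))))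
  w-as-fraction (suc zero) κ (+ suc q) =
    trans (if-∧-false (suc q ≤? suc κ) (suc κ + suc q ≤? suc κ) (ℕₚ.<⇒≱ (s≤s (ℕₚ.m<m+n κ ℕ.z<s))))
          (sym (/-zero κ (ℤₚ.*-zeroʳ (+ (suc κ C κ)))))
  w-as-fraction (suc (suc z)) κ (+ suc q) =
    if-∧-redundant (suc q ≤? suc κ) (suc κ + suc q ≤? suc (suc z) + κ) inner-index outside-k outside-z
    where
    B = (suc (suc z) + κ) C κ
    v = (+ B ℤ.* (+ (z C q) ℤ.* + (suc κ C suc q))) / suc κ
    inner-index : (+ (B * ((suc (suc z) + κ ∸ suc κ ∸ 1) C q) * (suc κ C suc q))) / suc κ ≡ v
    inner-index = begin
      (+ (B * ((suc z + κ ∸ κ ∸ 1) C q) * (suc κ C suc q))) / suc κ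
        ≡⟨ cong (λ t → (+ (B * ((t ∸ 1) C q) * (suc κ C suc q))) / suc κ) (ℕₚ.m+n∸n≡m (suc z) κ) ⟩
      (+ (B * (z C q) * (suc κ C suc q))) / suc κ
        ≡⟨ cong (_/ suc κ) (pos-*-assoc B (z C q) (suc κ C suc q)) ⟩
      v ∎
    outside-k : ¬ (suc q ≤ suc κ) → v ≡ 0ℚ
    outside-k q≰κ = /-zero κ (begin
      + B ℤ.* (+ (z C q) ℤ.* + (suc κ C suc q))  ≡⟨ cong (λ t → + B ℤ.* (+ (z C q) ℤ.* + t)) (k>n⇒nCk≡0 (ℕₚ.≰⇒> q≰κ)) ⟩
      + B ℤ.* (+ (z C q) ℤ.* 0ℤ)                ≡⟨ cong (+ B ℤ.*_) (ℤₚ.*-zeroʳ (+ (z C q))) ⟩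
      + B ℤ.* 0ℤ                                ≡⟨ ℤₚ.*-zeroʳ (+ B) ⟩
      0ℤ                                        ∎)
    outside-z : ¬ (suc κ + suc q ≤ suc (suc z) + κ) → v ≡ 0ℚ
    outside-z short = /-zero κ (begin
      + B ℤ.* (+ (z C q) ℤ.* + (suc κ C suc q))  ≡⟨ cong (λ t → + B ℤ.* (+ t ℤ.* + (suc κ C suc q))) (k>n⇒nCk≡0 z<q) ⟩
      + B ℤ.* 0ℤ                                ≡⟨ ℤₚ.*-zeroʳ (+ B) ⟩
      0ℤ                                        ∎)
      where
      z<q : q ℕ.> z
      z<q = ℕₚ.≰⇒> λ q≤z → short (s≤s (subst (_≤ suc (z + κ)) (sym (ℕₚ.+-suc κ q))
                                    (s≤s (subst (κ + q ≤_) (ℕₚ.+-comm κ z) (ℕₚ.+-monoʳ-≤ κ q≤z)))))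

open import Data.Rational using (_+_; _-_; _*_)

toℚᵘ-homo-- : ∀ p q → toℚᵘ (p - q) ℚᵘ.≃ toℚᵘ p ℚᵘ.- toℚᵘ q
toℚᵘ-homo-- p q = ℚᵘ.≃-trans (toℚᵘ-homo-+ p (Data.Rational.- q)) (ℚᵘ.+-congʳ (toℚᵘ p) (toℚᵘ-homo‿- q))

numerators⇒fractions : ∀ (P a₁ a₂ a₃ P₁ P₂ P₃ P₄ : ℤ) (k d₁ d₃ : ℕ) .{{_ : NonZero k}} .{{_ : NonZero d₁}} .{{_ : NonZero d₃}} →
  P ℤ.* (+ d₁ ℤ.* + d₃) ≡ (a₁ ℤ.* P₁ ℤ.- a₂ ℤ.* P₂) ℤ.* + d₃ ℤ.+ a₃ ℤ.* (P₃ ℤ.- P₄) ℤ.* + d₁ →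
  P / k ≡ (a₁ / d₁) * (P₁ / k) - (a₂ / d₁) * (P₂ / k) + (a₃ / d₃) * (P₃ / k - P₄ / k)
numerators⇒fractions P a₁ a₂ a₃ P₁ P₂ P₃ P₄ (suc k) (suc d₁) (suc d₃) numerators = toℚᵘ-injective (begin
  toℚᵘ (P / suc k)
    ≈⟨ toℚᵘ-/ P k ⟩
  ℚᵘ.mkℚᵘ P k
    ≈⟨ ℚᵘ.*≡* (rescaled P a₁ a₂ a₃ P₁ P₂ P₃ P₄ (+ suc k) (+ suc d₁) (+ suc d₃) numerators) ⟩
  ℚᵘ.mkℚᵘ a₁ d₁ ℚᵘ.* ℚᵘ.mkℚᵘ P₁ k ℚᵘ.- ℚᵘ.mkℚᵘ a₂ d₁ ℚᵘ.* ℚᵘ.mkℚᵘ P₂ k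
    ℚᵘ.+ ℚᵘ.mkℚᵘ a₃ d₃ ℚᵘ.* (ℚᵘ.mkℚᵘ P₃ k ℚᵘ.- ℚᵘ.mkℚᵘ P₄ k)
    ≈⟨ ℚᵘ.≃-sym (ℚᵘ.+-cong (ℚᵘ.+-cong (ℚᵘ.*-cong (toℚᵘ-/ a₁ d₁) (toℚᵘ-/ P₁ k))
                                      (ℚᵘ.-‿cong (ℚᵘ.*-cong (toℚᵘ-/ a₂ d₁) (toℚᵘ-/ P₂ k))))
                          (ℚᵘ.*-cong (toℚᵘ-/ a₃ d₃) (ℚᵘ.+-cong (toℚᵘ-/ P₃ k) (ℚᵘ.-‿cong (toℚᵘ-/ P₄ k))))) ⟩
  toℚᵘ x₁ ℚᵘ.* toℚᵘ y₁ ℚᵘ.- toℚᵘ x₂ ℚᵘ.* toℚᵘ y₂ ℚᵘ.+ toℚᵘ x₃ ℚᵘ.* (toℚᵘ y₃ ℚᵘ.- toℚᵘ y₄)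
    ≈⟨ ℚᵘ.≃-sym (ℚᵘ.≃-trans (toℚᵘ-homo-+ (x₁ * y₁ - x₂ * y₂) (x₃ * (y₃ - y₄)))
                 (ℚᵘ.+-cong (ℚᵘ.≃-trans (toℚᵘ-homo-- (x₁ * y₁) (x₂ * y₂))
                                        (ℚᵘ.+-cong (toℚᵘ-homo-* x₁ y₁) (ℚᵘ.-‿cong (toℚᵘ-homo-* x₂ y₂))))
                            (ℚᵘ.≃-trans (toℚᵘ-homo-* x₃ (y₃ - y₄)) (ℚᵘ.*-congˡ {toℚᵘ x₃} (toℚᵘ-homo-- y₃ y₄))))) ⟩
  toℚᵘ (x₁ * y₁ - x₂ * y₂ + x₃ * (y₃ - y₄)) ∎)
  where
  open import Relation.Binary.Reasoning.Setoid ℚᵘ.≃-setoid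
  x₁ = a₁ / suc d₁
  x₂ = a₂ / suc d₁
  x₃ = a₃ / suc d₃
  y₁ = P₁ / suc k
  y₂ = P₂ / suc k
  y₃ = P₃ / suc k
  y₄ = P₄ / suc k

lemma2p2 : (n k : ℕ) (m : ℤ) → 1 ≤ k → k ≤ suc n →
    w (n ℕ.+ 2) k m ≡
      ((+ (2 ℕ.* (n ℕ.+ 2) ℕ.* (suc n ∸ k))) / (suc (suc n ∸ k) ℕ.* suc (suc (suc n ∸ k)))) * w (n ℕ.+ 1) k m
      - ((+ (n ℕ.+ 2) ℤ.* (+ n ℤ.- + (2 ℕ.* k) ℤ.+ 1ℤ)) / (suc (suc n ∸ k) ℕ.* suc (suc (suc n ∸ k)))) * w (n ℕ.+ 1) k (m ℤ.- 1ℤ)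
      + ((+ ((n ℕ.+ 1) ℕ.* (n ℕ.+ 2)) ℤ.* (+ n ℤ.- + k)) / (suc (suc n ∸ k) ℕ.* suc (suc n ∸ k) ℕ.* suc (suc (suc n ∸ k))))
        * (w n k (m ℤ.- 1ℤ) - w n k m)
lemma2p2 n zero    m () _
lemma2p2 n (suc κ) m _  (s≤s κ≤n) with n ∸ κ | ℕₚ.m∸n+n≡m κ≤n
... | j | refl
  rewrite ℕₚ.+-comm (j ℕ.+ κ) 2 | ℕₚ.+-comm (j ℕ.+ κ) 1
        | w-as-fraction (suc (suc j)) κ m | w-as-fraction (suc j) κ m | w-as-fraction (suc j) κ (m ℤ.- 1ℤ)
        | w-as-fraction j κ (m ℤ.- 1ℤ) | w-as-fraction j κ m
  = numerators⇒fractions (b₂ ℤ.* w′ k (suc (suc j)) m) a₁ a₂ a₃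
      (b₁ ℤ.* w′ k (suc j) m) (b₁ ℤ.* w′ k (suc j) (m ℤ.- 1ℤ)) (b₀ ℤ.* w′ k j (m ℤ.- 1ℤ)) (b₀ ℤ.* w′ k j m)
      k (suc j ℕ.* suc (suc j)) (suc j ℕ.* suc j ℕ.* suc (suc j))
      (numerator-recurrence j κ {b₀} {b₁} {b₂} (w′-recurrence k j m)
        ([j+1]*[j+1+k]Ck≡[j+1+k]*[j+k]Ckℤ j κ) ([j+1]*[j+1+k]Ck≡[j+1+k]*[j+k]Ckℤ (suc j) κ))
  where
  k = suc κ
  b₀ = + ((j ℕ.+ κ) C κ)
  b₁ = + ((suc j ℕ.+ κ) C κ)
  b₂ = + ((suc (suc j) ℕ.+ κ) C κ)
  a₁ = + (2 ℕ.* suc (suc n) ℕ.* j)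
  a₂ = + suc (suc n) ℤ.* (+ n ℤ.- + (2 ℕ.* k) ℤ.+ 1ℤ)
  a₃ = + (suc n ℕ.* suc (suc n)) ℤ.* (+ n ℤ.- + k)
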